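{- For every $n\ge0$ and $k\ge0$, there exists a bijection between the set $\{(e,M): e\in\mathbf{I}_n,\ M\subseteq \mathrm{Em}(1\underline{01},e),\ |M|=k\}$ and the set $\{(e',M'): e'\in\mathbf{I}_n,\ M'\subseteq \mathrm{Em}(1\underline{10},e'),\ |M'|=k\}$.
   Context: $\mathbf{I}_n$ is the set of integer sequences $e_1\dots e_n$ with $0\le e_i<i$. For $e\in\mathbf{I}_n$, $\mathrm{Em}(1\underline{01},e)$ is the set of 3-element sets $\{t,i,i+1\}$ with $t<i$, $i+1\le n$ and $e_i<e_{i+1}=e_t$; $\mathrm{Em}(1\underline{10},e)$ is the set of 3-element sets $\{t,i,i+1\}$ with $t<i$, $i+1\le n$ and $e_t=e_i>e_{i+1}$ (these are the occurrences of the vincular patterns $1\underline{01}$ and $1\underline{10}$). -}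

module Defs where

open import Data.Nat using (ℕ; zero; suc; _≤_; _<ᵇ_; _≡ᵇ_; _+_)
open import Data.Bool using (Bool; true; false; _∧_)
open import Data.Fin using (Fin; toℕ)
open import Data.Fin.Subset using (Subset; _⊆_; ∣_∣)
open import Data.Vec using (Vec; []; _∷_; lookup; tabulate; foldr)
open import Data.Product using (_×_; _,_)
open import Data.Refinement using (Refinement)
open import Relation.Binary.PropositionalEquality using (_≡_)

-- Positions are 0-based: the entry e_{p+1} of the paper is stored at
-- position p : Fin n of a vector of length n.

IsInvSeq : {n : ℕ} → Vec ℕ n → Set
IsInvSeq {n} v = (p : Fin n) → lookup v p ≤ toℕ p

-- lookup by a natural-number position, default 0 out of range
-- (only ever used in range, guarded by the occurrence conditions)
_!_ : {n : ℕ} → Vec ℕ n → ℕ → ℕ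
[] ! _ = 0
(x ∷ v) ! zero = x
(x ∷ v) ! suc p = v ! p

-- The triple {t,i,i+1} (paper indices) is recorded by the 0-based pair
-- (t , i) of positions.  occ01 v t i = true iff {t+1,i+1,i+2} ∈ Em(1_01_, v):
--   t < i, i+2 ≤ n, e_{i+1} < e_{i+2} = e_{t+1}.
occ01 : {n : ℕ} → Vec ℕ n → Fin n → Fin n → Bool
occ01 {n} v t i =
  (toℕ t <ᵇ toℕ i) ∧ (suc (toℕ i) <ᵇ n)
  ∧ ((v ! toℕ i) <ᵇ (v ! suc (toℕ i))) ∧ ((v ! suc (toℕ i)) ≡ᵇ (v ! toℕ t))

occ10 : {n : ℕ} → Vec ℕ n → Fin n → Fin n → Bool
occ10 {n} v t i =
  (toℕ t <ᵇ toℕ i) ∧ (suc (toℕ i) <ᵇ n)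
  ∧ ((v ! toℕ t) ≡ᵇ (v ! toℕ i)) ∧ ((v ! suc (toℕ i)) <ᵇ (v ! toℕ i))

-- A set of triples {t,i,i+1} is a "matrix" of subsets: row i (a Subset n)
-- contains t iff the triple (t , i) is in the set.
Triples : ℕ → Set
Triples n = Vec (Subset n) n

EmOf : {n : ℕ} → (Vec ℕ n → Fin n → Fin n → Bool) → Vec ℕ n → Triples n
EmOf occ v = tabulate (λ i → tabulate (λ t → occ v t i))

Em01 Em10 : {n : ℕ} → Vec ℕ n → Triples n
Em01 = EmOf occ01
Em10 = EmOf occ10

_⊆ᵀ_ : {n : ℕ} → Triples n → Triples n → Set
_⊆ᵀ_ {n} M E = (i : Fin n) → lookup M i ⊆ lookup E i

card : {n : ℕ} → Triples n → ℕ
card M = foldr (λ _ → ℕ) (λ row acc → ∣ row ∣ + acc) 0 M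

-- { (e , M) : e ∈ I_n , M ⊆ Em(pattern, e) , |M| = k }
-- (proofs are irrelevant, so equality is equality of the pair (e , M))
MarkedSeqs : {n : ℕ} → (Vec ℕ n → Triples n) → ℕ → Set
MarkedSeqs {n} Em k =
  Refinement (Vec ℕ n × Triples n)
    (λ { (e , M) → IsInvSeq e × (M ⊆ᵀ Em e) × (card M ≡ k) })

module Submission where

-- Both patterns are "an adjacent pair (i , i + 1) whose larger value equals
-- e_t for some t < i"; they differ only in the direction o of the step from
-- e_i to e_{i+1} (ascending for 1_01_, descending for 1_10_).  Given (e , M),
-- call a row i marked when M contains a triple (t , i).  Maximal runs of
-- marked rows i ∈ [a , b) cut the positions into segments [a , b]; the map
--   Φ (e , M) = (e ∘ σ , M')   with   M' ∋ (t , i)  ⇔  M ∋ (σ t , ρ i)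
-- reverses every segment (σ p = a + b ∸ p) and the rows inside every run
-- (ρ i = a + b ∸ (i + 1)).  Along a segment e is strictly monotone in
-- direction o, so every witness t lies before the segment of i, and reversing
-- turns each chosen occurrence into one of the opposite direction.

open import Defs

open import Data.Bool using (Bool; true; false; _∧_; T; if_then_else_)
import Data.Bool.Properties as Bool
open import Data.Fin using (Fin; zero; suc; toℕ; fromℕ<)
open import Data.Fin.Permutation using (permutation)
open import Data.Fin.Properties using (toℕ-fromℕ<; toℕ<n; toℕ-injective; any?)
open import Data.Fin.Subset using (Subset; ∣_∣)
import Data.Irrelevant as Irrelevant
open import Data.Nat using (ℕ; zero; suc; _+_; _∸_; _≤_; _<_; z≤n; s≤s; _≤?_; _<?_; _≟_)
open import Data.Nat.Properties
open import Algebra.Properties.CommutativeMonoid.Sum +-0-commutativeMonoid using (sum; sum-permute; sum-cong-≗)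
open import Data.Product using (_×_; _,_; proj₁; proj₂; ∃)
open import Data.Refinement using (value; proof; value-injective; _,_)
open import Data.Sum using (inj₁; inj₂)
open import Data.Vec using (Vec; []; _∷_; lookup; tabulate; map; foldr)
open import Data.Vec.Properties using ([]=⇒lookup; lookup⇒[]=; lookup∘tabulate; tabulate∘lookup; tabulate-cong; lookup-map)
open import Function using (_∘_)
open import Function.Bundles using (_⇔_; mk⇔; _⤖_; mk↔ₛ′)
open import Function.Properties.Inverse using (↔⇒⤖)
open import Relation.Binary.PropositionalEquality
open import Relation.Nullary using (¬_; Dec; yes; no; does; contradiction)
open import Relation.Nullary.Decidable using (dec-true; dec-false; _×-dec_; does-⇔)
open import Relation.Unary using (Decidable)

module IntervalReflection {a b q : ℕ} (a≤q : a ≤ q) (q≤b : q ≤ b) where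

  reflect-≥ : a ≤ a + b ∸ q
  reflect-≥ = subst (_≤ a + b ∸ q) (m+n∸n≡m a b) (∸-monoʳ-≤ (a + b) q≤b)

  reflect-≤ : a + b ∸ q ≤ b
  reflect-≤ = subst (a + b ∸ q ≤_) (m+n∸m≡n a b) (∸-monoʳ-≤ (a + b) a≤q)

  reflect-involutive : a + b ∸ (a + b ∸ q) ≡ q
  reflect-involutive = m∸[m∸n]≡n (≤-trans q≤b (m≤n+m b a))

-- Row r joins the
-- positions r and r + 1; the segment of p is [start p , end p], where all
-- rows start p … end p ∸ 1 are marked and the rows just outside are not.
-- Marked rows lie below n ∸ 1, so positions below n stay below n.
module Segments {n : ℕ} {Marked : ℕ → Set} (marked? : Decidable Marked)
                (bounded : ∀ {r} → Marked r → suc r < n) where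

  start : ℕ → ℕ
  start zero = zero
  start (suc p) = if does (marked? p) then start p else suc p

  -- walk up from p across marked rows, with fuel f (n steps always suffice)
  end′ : ℕ → ℕ → ℕ
  end′ zero p = p
  end′ (suc f) p = if does (marked? p) then end′ f (suc p) else p

  end : ℕ → ℕ
  end = end′ n

  start-step : ∀ {r} → Marked r → start (suc r) ≡ start r
  start-step {r} mr with marked? r
  ... | yes _ = refl
  ... | no ¬mr = contradiction mr ¬mr

  start-≤ : ∀ p → start p ≤ p
  start-≤ zero = z≤n
  start-≤ (suc p) with marked? p
  ... | yes _ = m≤n⇒m≤1+n (start-≤ p)
  ... | no _ = ≤-refl

  start-marked : ∀ {p r} → start p ≤ r → r < p → Marked r
  start-marked {suc p} {r} s≤r r<sp with marked? p
  ... | no _ = contradiction r<sp (≤⇒≯ s≤r)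
  ... | yes mp with m≤n⇒m<n∨m≡n (≤-pred r<sp)
  ...   | inj₁ r<p = start-marked s≤r r<p
  ...   | inj₂ refl = mp

  start-boundary : ∀ {p a} → start p ≡ suc a → ¬ Marked a
  start-boundary {suc p} eq with marked? p
  ... | yes _ = start-boundary {p} eq
  ... | no ¬mp = subst (λ x → ¬ Marked x) (suc-injective eq) ¬mp

  beyond : ∀ {p} → n ≤ p → ¬ Marked p
  beyond {p} n≤p mp = <⇒≱ (bounded mp) (≤-trans n≤p (n≤1+n p))

  end′-≥ : ∀ f p → p ≤ end′ f p
  end′-≥ zero p = ≤-refl
  end′-≥ (suc f) p with marked? p
  ... | yes _ = ≤-trans (n≤1+n p) (end′-≥ f (suc p))
  ... | no _ = ≤-refl

  end′-marked : ∀ f {p r} → p ≤ r → r < end′ f p → Marked r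
  end′-marked zero p≤r r<p = contradiction r<p (≤⇒≯ p≤r)
  end′-marked (suc f) {p} p≤r r<e with marked? p
  ... | no _ = contradiction r<e (≤⇒≯ p≤r)
  ... | yes mp with m≤n⇒m<n∨m≡n p≤r
  ...   | inj₁ p<r = end′-marked f p<r r<e
  ...   | inj₂ refl = mp

  end′-suc : ∀ f p → n ≤ p + f → end′ (suc f) p ≡ end′ f p
  end′-suc zero p n≤p with marked? p
  ... | yes mp = contradiction mp (beyond (subst (n ≤_) (+-identityʳ p) n≤p))
  ... | no _ = refl
  end′-suc (suc f) p n≤p+sf with marked? p
  ... | yes _ = end′-suc f (suc p) (≤-trans n≤p+sf (≤-reflexive (+-suc p f)))
  ... | no _ = refl

  end′-boundary : ∀ f p → n ≤ p + f → ¬ Marked (end′ f p)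
  end′-boundary zero p n≤p = beyond (subst (n ≤_) (+-identityʳ p) n≤p)
  end′-boundary (suc f) p n≤p+sf with marked? p
  ... | yes _ = end′-boundary f (suc p) (≤-trans n≤p+sf (≤-reflexive (+-suc p f)))
  ... | no ¬mp = ¬mp

  end-step : ∀ {r} → Marked r → end r ≡ end (suc r)
  end-step {r} mr with marked? r | end′-suc n r (m≤n+m n r)
  ... | yes _ | e = sym e
  ... | no ¬mr | _ = contradiction mr ¬mr

  end-≥ : ∀ p → p ≤ end p
  end-≥ = end′-≥ n

  end-marked : ∀ {p r} → p ≤ r → r < end p → Marked r
  end-marked = end′-marked n

  end-boundary : ∀ p → ¬ Marked (end p)
  end-boundary p = end′-boundary n p (m≤n+m n p)

  segment-marked : ∀ {p r} → start p ≤ r → r < end p → Marked r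
  segment-marked {p} {r} s≤r r<e with r <? p
  ... | yes r<p = start-marked s≤r r<p
  ... | no r≮p = end-marked (≮⇒≥ r≮p) r<e

  run-constant : ∀ {a} b → a ≤ b → (∀ r → a ≤ r → r < b → Marked r) →
                 start b ≡ start a × end b ≡ end a
  run-constant zero z≤n _ = refl , refl
  run-constant {a} (suc b) a≤sb marked with m≤n⇒m<n∨m≡n a≤sb
  ... | inj₂ refl = refl , refl
  ... | inj₁ (s≤s a≤b) = trans (start-step mb) (proj₁ ih) , trans (sym (end-step mb)) (proj₂ ih)
    where
    mb : Marked b
    mb = marked b a≤b ≤-refl
    ih : start b ≡ start a × end b ≡ end a
    ih = run-constant b a≤b (λ r a≤r r<b → marked r a≤r (m<n⇒m<1+n r<b))

  same-segment : ∀ {p q} → start p ≤ q → q ≤ end p → start q ≡ start p × end q ≡ end p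
  same-segment {p} {q} s≤q q≤e =
    trans (proj₁ at-q) (sym (proj₁ at-p)) , trans (proj₂ at-q) (sym (proj₂ at-p))
    where
    run : ∀ {b} → b ≤ end p → ∀ r → start p ≤ r → r < b → Marked r
    run b≤e r s≤r r<b = segment-marked s≤r (<-≤-trans r<b b≤e)
    at-q : start q ≡ start (start p) × end q ≡ end (start p)
    at-q = run-constant q s≤q (run q≤e)
    at-p : start p ≡ start (start p) × end p ≡ end (start p)
    at-p = run-constant p (start-≤ p) (run (end-≥ p))

  run-bounded : ∀ {p} b → p < b → (∀ r → p ≤ r → r < b → Marked r) → b < n
  run-bounded (suc r) (s≤s p≤r) marked = bounded (marked r p≤r ≤-refl)

  end-< : ∀ {p} → p < n → end p < n
  end-< {p} p<n with m≤n⇒m<n∨m≡n (end-≥ p)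
  ... | inj₁ p<e = run-bounded (end p) p<e (λ r → end-marked)
  ... | inj₂ p≡e = subst (_< n) p≡e p<n

  end-before : ∀ {t p} → t < start p → end t < start p
  end-before {t} {p} t<s = go (start p) refl t<s
    where
    go : ∀ b → start p ≡ b → t < b → end t < b
    go (suc a) eq (s≤s t≤a) with end t ≤? a
    ... | yes e≤a = s≤s e≤a
    ... | no e≰a = contradiction (end-marked t≤a (≰⇒> e≰a)) (start-boundary {p} eq)

  σ : ℕ → ℕ
  σ p = start p + end p ∸ p

  σ-on-segment : ∀ {p q} → start p ≤ q → q ≤ end p → σ q ≡ start p + end p ∸ q
  σ-on-segment {p} {q} s≤q q≤e =
    cong₂ (λ a b → a + b ∸ q) (proj₁ (same-segment s≤q q≤e)) (proj₂ (same-segment s≤q q≤e))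

  σ-≥ : ∀ p → start p ≤ σ p
  σ-≥ p = IntervalReflection.reflect-≥ (start-≤ p) (end-≥ p)

  σ-≤ : ∀ p → σ p ≤ end p
  σ-≤ p = IntervalReflection.reflect-≤ (start-≤ p) (end-≥ p)

  σ-involutive : ∀ p → σ (σ p) ≡ p
  σ-involutive p = trans (σ-on-segment (σ-≥ p) (σ-≤ p))
                         (IntervalReflection.reflect-involutive (start-≤ p) (end-≥ p))

  σ-< : ∀ {p} → p < n → σ p < n
  σ-< {p} p<n = ≤-<-trans (σ-≤ p) (end-< p<n)

  σ-before : ∀ {t p} → t < start p → σ t < start p
  σ-before {t} {p} t<s = ≤-<-trans (σ-≤ t) (end-before {t} {p} t<s)

  σ-trivial : ∀ {p} → start p ≡ end p → σ p ≡ p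
  σ-trivial {p} s≡e = trans (squeeze (σ-≥ p) (σ-≤ p)) (sym (squeeze (start-≤ p) (end-≥ p)))
    where
    squeeze : ∀ {q} → start p ≤ q → q ≤ end p → q ≡ start p
    squeeze s≤q q≤e = ≤-antisym (subst (_ ≤_) (sym s≡e) q≤e) s≤q

  -- ρ reverses the marked rows of every segment (the pair (i , i + 1) goes to
  -- (σ (i + 1) , σ i)) and fixes the unmarked rows
  ρ : ℕ → ℕ
  ρ r = if does (marked? r) then σ (suc r) else r

  ρ-unmarked : ∀ {r} → ¬ Marked r → ρ r ≡ r
  ρ-unmarked {r} ¬mr = cong (λ b → if b then σ (suc r) else r) (dec-false (marked? r) ¬mr)

  module MarkedRow {i : ℕ} (mi : Marked i) where

    ρ-marked : ρ i ≡ σ (suc i)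
    ρ-marked = cong (λ b → if b then σ (suc i) else i) (dec-true (marked? i) mi)

    <-end : i < end i
    <-end with m≤n⇒m<n∨m≡n (end-≥ i)
    ... | inj₁ i<e = i<e
    ... | inj₂ i≡e = contradiction (subst Marked i≡e mi) (end-boundary i)

    suc-ρ : suc (ρ i) ≡ σ i
    suc-ρ = begin
      suc (ρ i)                           ≡⟨ cong suc ρ-marked ⟩
      suc (σ (suc i))                     ≡⟨ cong₂ (λ a b → suc (a + b ∸ suc i)) (start-step mi) (sym (end-step mi)) ⟩
      suc (start i + end i ∸ suc i)       ≡⟨ +-∸-assoc 1 (≤-trans <-end (m≤n+m (end i) (start i))) ⟨
      σ i                                 ∎
      where open ≡-Reasoning

    σ-ρ : σ (ρ i) ≡ suc i
    σ-ρ = trans (cong σ ρ-marked) (σ-involutive (suc i))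

    σ-suc-ρ : σ (suc (ρ i)) ≡ i
    σ-suc-ρ = trans (cong σ suc-ρ) (σ-involutive i)

    start-≤-ρ : start i ≤ ρ i
    start-≤-ρ = subst₂ _≤_ (start-step mi) (sym ρ-marked) (σ-≥ (suc i))

    ρ-<-end : suc (ρ i) ≤ end i
    ρ-<-end = subst (_≤ end i) (sym suc-ρ) (σ-≤ i)

    ρ-marked-row : Marked (ρ i)
    ρ-marked-row = segment-marked {i} start-≤-ρ ρ-<-end

  ρ-involutive : ∀ r → ρ (ρ r) ≡ r
  ρ-involutive r = by-cases (marked? r)
    where
    by-cases : Dec (Marked r) → ρ (ρ r) ≡ r
    by-cases (no ¬mr) = trans (cong ρ (ρ-unmarked ¬mr)) (ρ-unmarked ¬mr)
    by-cases (yes mr) = trans (MarkedRow.ρ-marked ρ-marked-row) σ-suc-ρ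
      where open MarkedRow mr

  ρ-< : ∀ {r} → r < n → ρ r < n
  ρ-< {r} r<n = by-cases (marked? r)
    where
    by-cases : Dec (Marked r) → ρ r < n
    by-cases (no ¬mr) = subst (_< n) (sym (ρ-unmarked ¬mr)) r<n
    by-cases (yes mr) = ≤-trans ρ-<-end (<⇒≤ (end-< r<n))
      where open MarkedRow mr

module SameMarks {n : ℕ} {P Q : ℕ → Set} (P? : Decidable P) (Q? : Decidable Q)
                 (boundedP : ∀ {r} → P r → suc r < n) (boundedQ : ∀ {r} → Q r → suc r < n)
                 (same : ∀ r → does (P? r) ≡ does (Q? r)) where

  private
    module SP = Segments P? boundedP
    module SQ = Segments Q? boundedQ

  start-cong : ∀ p → SP.start p ≡ SQ.start p
  start-cong zero = refl
  start-cong (suc p) = cong₂ (λ b s → if b then s else suc p) (same p) (start-cong p)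

  end′-cong : ∀ f p → SP.end′ f p ≡ SQ.end′ f p
  end′-cong zero p = refl
  end′-cong (suc f) p = cong₂ (λ b e → if b then e else p) (same p) (end′-cong f (suc p))

  σ-cong : ∀ p → SP.σ p ≡ SQ.σ p
  σ-cong p = cong₂ (λ s e → s + e ∸ p) (start-cong p) (end′-cong n p)

  ρ-cong : ∀ r → SP.ρ r ≡ SQ.ρ r
  ρ-cong r = cong₂ (λ b x → if b then x else r) (same r) (σ-cong (suc r))

-- The direction of the step from e_i to e_{i+1} in an occurrence {t , i , i + 1}.
data Orientation : Set where
  ascending descending : Orientation

flip : Orientation → Orientation
flip ascending = descending
flip descending = ascending

Rise : Orientation → ℕ → ℕ → Set
Rise ascending x y = x < y
Rise descending x y = y < x

Rise-trans : ∀ o {x y z} → Rise o x y → Rise o y z → Rise o x z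
Rise-trans ascending x<y y<z = <-trans x<y y<z
Rise-trans descending y<x z<y = <-trans z<y y<x

Rise-irrefl : ∀ o {x} → ¬ Rise o x x
Rise-irrefl ascending = <-irrefl refl
Rise-irrefl descending = <-irrefl refl

Rise-flip : ∀ o {x y} → Rise o x y → Rise (flip o) y x
Rise-flip ascending x<y = x<y
Rise-flip descending y<x = y<x

-- the position of the larger value in the adjacent pair (i , i + 1)
top : Orientation → ℕ → ℕ
top ascending i = suc i
top descending i = i

top-≥ : ∀ o i → i ≤ top o i
top-≥ ascending i = n≤1+n i
top-≥ descending i = ≤-refl

top-≤ : ∀ o i → top o i ≤ suc i
top-≤ ascending i = ≤-refl
top-≤ descending i = n≤1+n i

-- Ascending occurrences are those of 1_01_, descending ones those of 1_10_.
record Occurrence (o : Orientation) (n : ℕ) (E : ℕ → ℕ) (t i : ℕ) : Set where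
  constructor occurrence
  field
    t<i : t < i
    i+1<n : suc i < n
    rise : Rise o (E i) (E (suc i))
    top≡ : E (top o i) ≡ E t

occurrence-values : ∀ {o n E t i} → Occurrence o n E t i → E i ≤ E t × E (suc i) ≤ E t
occurrence-values {ascending} {E = E} {i = i} (occurrence _ _ rise top≡) =
  <⇒≤ (subst (E i <_) top≡ rise) , ≤-reflexive top≡
occurrence-values {descending} {E = E} {i = i} (occurrence _ _ rise top≡) =
  ≤-reflexive top≡ , <⇒≤ (subst (E (suc i) <_) top≡ rise)

rise-along : ∀ o (E : ℕ → ℕ) {s s′} → (∀ r → s ≤ r → r < s′ → Rise o (E r) (E (suc r))) →
             s < s′ → Rise o (E s) (E s′)
rise-along o E {s} {suc s′} steps (s≤s s≤s′) with m≤n⇒m<n∨m≡n s≤s′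
... | inj₂ refl = steps s ≤-refl ≤-refl
... | inj₁ s<s′ = Rise-trans o (rise-along o E (λ r s≤r r<s′ → steps r s≤r (m<n⇒m<1+n r<s′)) s<s′)
                               (steps s′ s≤s′ ≤-refl)

module ReflectOccurrences {n : ℕ} {Marked : ℕ → Set} (marked? : Decidable Marked)
         (bounded : ∀ {r} → Marked r → suc r < n) (o : Orientation) (E : ℕ → ℕ)
         (marked-occurrence : ∀ {i} → Marked i → ∃ λ t → Occurrence o n E t i) where

  open Segments marked? bounded

  marked-rise : ∀ {r} → Marked r → Rise o (E r) (E (suc r))
  marked-rise mr = Occurrence.rise (proj₂ (marked-occurrence mr))

  -- E is strictly monotone on a segment, so the value E t shared by the
  -- witness t and the pair (i , i + 1) forces t to lie before i's segment
  witness-before : ∀ {t i} → Occurrence o n E t i → Marked i → t < start i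
  witness-before {t} {i} oc mi with t <? start i
  ... | yes t<s = t<s
  ... | no t≮s = contradiction (subst (Rise o (E t)) (Occurrence.top≡ oc) t⇝top) (Rise-irrefl o)
    where
    open MarkedRow mi
    t<top : t < top o i
    t<top = <-≤-trans (Occurrence.t<i oc) (top-≥ o i)
    t⇝top : Rise o (E t) (E (top o i))
    t⇝top = rise-along o E (λ r t≤r r<top → marked-rise (segment-marked {i} (≤-trans (≮⇒≥ t≮s) t≤r)
                               (<-≤-trans r<top (≤-trans (top-≤ o i) <-end)))) t<top

  σ-top : ∀ o′ {i} → Marked i → σ (top (flip o′) (ρ i)) ≡ top o′ i
  σ-top ascending mi = MarkedRow.σ-ρ mi
  σ-top descending mi = MarkedRow.σ-suc-ρ mi

  reflect-occurrence : ∀ {t i} → Occurrence o n E t i → Marked i →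
                       Occurrence (flip o) n (E ∘ σ) (σ t) (ρ i)
  reflect-occurrence {t} {i} oc mi = occurrence
    (<-≤-trans (σ-before {t} {i} (witness-before oc mi)) start-≤-ρ)
    (≤-<-trans ρ-<-end (end-< (<-trans (n<1+n i) (Occurrence.i+1<n oc))))
    (subst₂ (Rise (flip o)) (cong E (sym σ-ρ)) (cong E (sym σ-suc-ρ)) (Rise-flip o (Occurrence.rise oc)))
    (trans (cong E (σ-top o mi)) (trans (Occurrence.top≡ oc) (cong E (sym (σ-involutive t)))))
    where open MarkedRow mi

  reflected-occurrence : ∀ {t i} → Occurrence o n E (σ t) (ρ i) → Marked (ρ i) →
                         Occurrence (flip o) n (E ∘ σ) t i
  reflected-occurrence {t} {i} oc mi =
    subst₂ (Occurrence (flip o) n (E ∘ σ)) (σ-involutive t) (ρ-involutive i) (reflect-occurrence oc mi)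

  module _ (inversion : ∀ p → p < n → E p ≤ p) where

    -- both values of a marked row are below the start of its segment, since
    -- they are at most E t ≤ t for a witness t before the segment
    marked-values : ∀ {r} → Marked r → E r < start r × E (suc r) < start r
    marked-values {r} mr = below (proj₁ (occurrence-values oc)) , below (proj₂ (occurrence-values oc))
      where
      t : ℕ
      t = proj₁ (marked-occurrence mr)
      oc : Occurrence o n E t r
      oc = proj₂ (marked-occurrence mr)
      t<n : t < n
      t<n = <-trans (Occurrence.t<i oc) (<-trans (n<1+n r) (Occurrence.i+1<n oc))
      below : ∀ {x} → x ≤ E t → x < start r
      below x≤Et = ≤-<-trans (≤-trans x≤Et (inversion t t<n)) (witness-before oc mr)

    value-past-start : ∀ q → start q < q → E q < start q
    value-past-start (suc r) s<sr = subst (E (suc r) <_) (sym (start-step mr)) (proj₂ (marked-values mr))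
      where
      mr : Marked r
      mr = start-marked {suc r} (≤-pred s<sr) ≤-refl

    segment-values : ∀ q → start q < end q → E q < start q
    segment-values q s<e with m≤n⇒m<n∨m≡n (end-≥ q)
    ... | inj₁ q<e = proj₁ (marked-values (end-marked ≤-refl q<e))
    ... | inj₂ q≡e = value-past-start q (subst (start q <_) (sym q≡e) s<e)

    reflect-inversion : ∀ p → p < n → E (σ p) ≤ p
    reflect-inversion p p<n with m≤n⇒m<n∨m≡n (≤-trans (start-≤ p) (end-≥ p))
    ... | inj₂ s≡e = subst (λ q → E q ≤ p) (sym (σ-trivial s≡e)) (inversion p p<n)
    ... | inj₁ s<e = <⇒≤ (<-≤-trans (segment-values (σ p) (subst₂ _<_ (sym s′) (sym e′) s<e))
                                    (≤-trans (≤-reflexive s′) (start-≤ p)))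
      where
      s′ : start (σ p) ≡ start p
      s′ = proj₁ (same-segment {p} (σ-≥ p) (σ-≤ p))
      e′ : end (σ p) ≡ end p
      e′ = proj₂ (same-segment {p} (σ-≥ p) (σ-≤ p))

!-lookup : ∀ {n} (v : Vec ℕ n) (p : Fin n) → v ! toℕ p ≡ lookup v p
!-lookup (x ∷ v) zero = refl
!-lookup (x ∷ v) (suc p) = !-lookup v p

!-fromℕ< : ∀ {n} (v : Vec ℕ n) {x} (x<n : x < n) → v ! x ≡ lookup v (fromℕ< x<n)
!-fromℕ< v x<n = trans (cong (v !_) (sym (toℕ-fromℕ< x<n))) (!-lookup v (fromℕ< x<n))

inversion-ℕ : ∀ {n} {e : Vec ℕ n} → IsInvSeq e → ∀ p → p < n → e ! p ≤ p
inversion-ℕ {e = e} inv p p<n =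
  subst₂ _≤_ (sym (!-fromℕ< e p<n)) (toℕ-fromℕ< p<n) (inv (fromℕ< p<n))

permute : ∀ {A : Set} {n} → (Fin n → Fin n) → Vec A n → Vec A n
permute π v = tabulate (lookup v ∘ π)

lookup-permute : ∀ {A : Set} {n} (π : Fin n → Fin n) (v : Vec A n) p → lookup (permute π v) p ≡ lookup v (π p)
lookup-permute π v = lookup∘tabulate (lookup v ∘ π)

lookup-ext : ∀ {A : Set} {n} {u v : Vec A n} → (∀ p → lookup u p ≡ lookup v p) → u ≡ v
lookup-ext {u = u} {v} eq = trans (sym (tabulate∘lookup u)) (trans (tabulate-cong eq) (tabulate∘lookup v))

sum-permute-involution : ∀ {A : Set} {n} (π : Fin n → Fin n) → (∀ p → π (π p) ≡ p) →
                         ∀ (g : A → ℕ) v → sum (g ∘ lookup (permute π v)) ≡ sum (g ∘ lookup v)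
sum-permute-involution π invol g v = begin
  sum (g ∘ lookup (permute π v))  ≡⟨ sum-cong-≗ (cong g ∘ lookup-permute π v) ⟩
  sum (g ∘ lookup v ∘ π)          ≡⟨ sum-permute (g ∘ lookup v) (permutation π π invol invol) ⟨
  sum (g ∘ lookup v)              ∎
  where open ≡-Reasoning

weight : Bool → ℕ
weight true = 1
weight false = 0

∣∣-sum : ∀ {n} (p : Subset n) → ∣ p ∣ ≡ sum (weight ∘ lookup p)
∣∣-sum [] = refl
∣∣-sum (true ∷ p) = cong suc (∣∣-sum p)
∣∣-sum (false ∷ p) = ∣∣-sum p

card-sum : ∀ {n} (M : Triples n) → card M ≡ sum (∣_∣ ∘ lookup M)
card-sum = go
  where
  go : ∀ {n k} (M : Vec (Subset n) k) → foldr (λ _ → ℕ) (λ row acc → ∣ row ∣ + acc) 0 M ≡ sum (∣_∣ ∘ lookup M)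
  go [] = refl
  go (row ∷ M) = cong (∣ row ∣ +_) (go M)

cell : ∀ {n} → Triples n → Fin n → Fin n → Bool
cell M i t = lookup (lookup M i) t

RowMarked : ∀ {n} → Triples n → ℕ → Set
RowMarked {n} M r = suc r < n × ∃ λ (i : Fin n) → toℕ i ≡ r × ∃ λ t → cell M i t ≡ true

rowMarked? : ∀ {n} (M : Triples n) → Decidable (RowMarked M)
rowMarked? {n} M r = (suc r <? n) ×-dec any? (λ i → (toℕ i ≟ r) ×-dec any? (λ t → cell M i t Bool.≟ true))

module SegmentsOf {n} (M : Triples n) = Segments (rowMarked? M) proj₁

restrict : ∀ {n} (f : ℕ → ℕ) → (∀ {p} → p < n → f p < n) → Fin n → Fin n
restrict f f-< p = fromℕ< (f-< (toℕ<n p))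

toℕ-restrict : ∀ {n} {f : ℕ → ℕ} (f-< : ∀ {p} → p < n → f p < n) p → toℕ (restrict f f-< p) ≡ f (toℕ p)
toℕ-restrict f-< p = toℕ-fromℕ< (f-< (toℕ<n p))

restrict-involutive : ∀ {n} {f : ℕ → ℕ} (f-< : ∀ {p} → p < n → f p < n) →
                      (∀ p → f (f p) ≡ p) → ∀ p → restrict f f-< (restrict f f-< p) ≡ p
restrict-involutive {f = f} f-< invol p = toℕ-injective (begin
  toℕ (restrict f f-< (restrict f f-< p))  ≡⟨ toℕ-restrict f-< (restrict f f-< p) ⟩
  f (toℕ (restrict f f-< p))               ≡⟨ cong f (toℕ-restrict f-< p) ⟩
  f (f (toℕ p))                            ≡⟨ invol (toℕ p) ⟩
  toℕ p                                    ∎)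
  where open ≡-Reasoning

restrict-cong : ∀ {n} {f g : ℕ → ℕ} (f-< : ∀ {p} → p < n → f p < n) (g-< : ∀ {p} → p < n → g p < n) →
                (∀ p → f p ≡ g p) → ∀ p → restrict f f-< p ≡ restrict g g-< p
restrict-cong f-< g-< f≗g p =
  toℕ-injective (trans (toℕ-restrict f-< p) (trans (f≗g (toℕ p)) (sym (toℕ-restrict g-< p))))

σ[_] : ∀ {n} → Triples n → Fin n → Fin n
σ[ M ] = restrict (SegmentsOf.σ M) (SegmentsOf.σ-< M)

ρ[_] : ∀ {n} → Triples n → Fin n → Fin n
ρ[ M ] = restrict (SegmentsOf.ρ M) (SegmentsOf.ρ-< M)

toℕ-σ[] : ∀ {n} (M : Triples n) p → toℕ (σ[ M ] p) ≡ SegmentsOf.σ M (toℕ p)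
toℕ-σ[] M = toℕ-restrict (SegmentsOf.σ-< M)

toℕ-ρ[] : ∀ {n} (M : Triples n) i → toℕ (ρ[ M ] i) ≡ SegmentsOf.ρ M (toℕ i)
toℕ-ρ[] M = toℕ-restrict (SegmentsOf.ρ-< M)

σ[]-involutive : ∀ {n} (M : Triples n) p → σ[ M ] (σ[ M ] p) ≡ p
σ[]-involutive M = restrict-involutive (SegmentsOf.σ-< M) (SegmentsOf.σ-involutive M)

ρ[]-involutive : ∀ {n} (M : Triples n) i → ρ[ M ] (ρ[ M ] i) ≡ i
ρ[]-involutive M = restrict-involutive (SegmentsOf.ρ-< M) (SegmentsOf.ρ-involutive M)

ΦM : ∀ {n} → Triples n → Triples n
ΦM M = permute ρ[ M ] (map (permute σ[ M ]) M)

Φ : ∀ {n} → Vec ℕ n × Triples n → Vec ℕ n × Triples n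
Φ (e , M) = permute σ[ M ] e , ΦM M

cell-Φ : ∀ {n} (M : Triples n) i t → cell (ΦM M) i t ≡ cell M (ρ[ M ] i) (σ[ M ] t)
cell-Φ M i t = begin
  cell (ΦM M) i t                                      ≡⟨ cong (λ row → lookup row t) (lookup-permute ρ[ M ] (map (permute σ[ M ]) M) i) ⟩
  lookup (lookup (map (permute σ[ M ]) M) (ρ[ M ] i)) t ≡⟨ cong (λ row → lookup row t) (lookup-map (ρ[ M ] i) _ M) ⟩
  lookup (permute σ[ M ] (lookup M (ρ[ M ] i))) t      ≡⟨ lookup-permute σ[ M ] (lookup M (ρ[ M ] i)) t ⟩
  cell M (ρ[ M ] i) (σ[ M ] t)                         ∎
  where open ≡-Reasoning

-- ΦM permutes rows and, inside each row, columns; so it keeps the number of triples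
card-Φ : ∀ {n} (M : Triples n) → card (ΦM M) ≡ card M
card-Φ M = begin
  card (ΦM M)                                      ≡⟨ card-sum (ΦM M) ⟩
  sum (∣_∣ ∘ lookup (ΦM M))                        ≡⟨ sum-permute-involution ρ[ M ] (ρ[]-involutive M) ∣_∣ (map (permute σ[ M ]) M) ⟩
  sum (∣_∣ ∘ lookup (map (permute σ[ M ]) M))      ≡⟨ sum-cong-≗ (λ i → cong ∣_∣ (lookup-map i _ M)) ⟩
  sum (λ i → ∣ permute σ[ M ] (lookup M i) ∣)      ≡⟨ sum-cong-≗ (λ i → ∣permute∣ (lookup M i)) ⟩
  sum (∣_∣ ∘ lookup M)                             ≡⟨ card-sum M ⟨
  card M                                           ∎
  where
  open ≡-Reasoning
  ∣permute∣ : ∀ p → ∣ permute σ[ M ] p ∣ ≡ ∣ p ∣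
  ∣permute∣ p = trans (∣∣-sum (permute σ[ M ] p))
                      (trans (sum-permute-involution σ[ M ] (σ[]-involutive M) weight p) (sym (∣∣-sum p)))

marked-Φ : ∀ {n} (M : Triples n) r → RowMarked (ΦM M) r ⇔ RowMarked M r
marked-Φ M r = mk⇔ to from
  where
  open SegmentsOf M using (ρ; ρ-unmarked; module MarkedRow)
  to : RowMarked (ΦM M) r → RowMarked M r
  to (r+1<n , i , i≡r , t , c) with rowMarked? M r
  ... | yes mr = mr
  ... | no ¬mr = r+1<n , ρ[ M ] i , trans (toℕ-ρ[] M i) (trans (cong ρ i≡r) (ρ-unmarked ¬mr)) ,
                 σ[ M ] t , trans (sym (cell-Φ M i t)) c
  from : RowMarked M r → RowMarked (ΦM M) r
  from mr@(r+1<n , i , i≡r , _) with MarkedRow.ρ-marked-row mr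
  ... | (_ , j , j≡ρr , u , c) = r+1<n , i , i≡r , σ[ M ] u , (begin
    cell (ΦM M) i (σ[ M ] u)                 ≡⟨ cell-Φ M i (σ[ M ] u) ⟩
    cell M (ρ[ M ] i) (σ[ M ] (σ[ M ] u))    ≡⟨ cong₂ (cell M) ρi≡j (σ[]-involutive M u) ⟩
    cell M j u                               ≡⟨ c ⟩
    true                                     ∎)
    where
    open ≡-Reasoning
    ρi≡j : ρ[ M ] i ≡ j
    ρi≡j = toℕ-injective (trans (toℕ-ρ[] M i) (trans (cong ρ i≡r) (sym j≡ρr)))

module SegmentsOfΦ {n} (M : Triples n) =
  SameMarks (rowMarked? (ΦM M)) (rowMarked? M) proj₁ proj₁ (λ r → does-⇔ (marked-Φ M r) (rowMarked? (ΦM M) r) (rowMarked? M r))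

σ[]-Φ : ∀ {n} (M : Triples n) p → σ[ ΦM M ] p ≡ σ[ M ] p
σ[]-Φ M = restrict-cong (SegmentsOf.σ-< (ΦM M)) (SegmentsOf.σ-< M) (SegmentsOfΦ.σ-cong M)

ρ[]-Φ : ∀ {n} (M : Triples n) i → ρ[ ΦM M ] i ≡ ρ[ M ] i
ρ[]-Φ M = restrict-cong (SegmentsOf.ρ-< (ΦM M)) (SegmentsOf.ρ-< M) (SegmentsOfΦ.ρ-cong M)

Φ-involutive : ∀ {n} (x : Vec ℕ n × Triples n) → Φ (Φ x) ≡ x
Φ-involutive (e , M) = cong₂ _,_ (lookup-ext e-entries) (lookup-ext λ i → lookup-ext (M-entries i))
  where
  open ≡-Reasoning
  e-entries : ∀ p → lookup (permute σ[ ΦM M ] (permute σ[ M ] e)) p ≡ lookup e p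
  e-entries p = begin
    lookup (permute σ[ ΦM M ] (permute σ[ M ] e)) p  ≡⟨ lookup-permute σ[ ΦM M ] (permute σ[ M ] e) p ⟩
    lookup (permute σ[ M ] e) (σ[ ΦM M ] p)          ≡⟨ lookup-permute σ[ M ] e _ ⟩
    lookup e (σ[ M ] (σ[ ΦM M ] p))                  ≡⟨ cong (lookup e ∘ σ[ M ]) (σ[]-Φ M p) ⟩
    lookup e (σ[ M ] (σ[ M ] p))                     ≡⟨ cong (lookup e) (σ[]-involutive M p) ⟩
    lookup e p                                       ∎
  M-entries : ∀ i t → cell (ΦM (ΦM M)) i t ≡ cell M i t
  M-entries i t = begin
    cell (ΦM (ΦM M)) i t                                              ≡⟨ cell-Φ (ΦM M) i t ⟩
    cell (ΦM M) (ρ[ ΦM M ] i) (σ[ ΦM M ] t)                           ≡⟨ cell-Φ M (ρ[ ΦM M ] i) (σ[ ΦM M ] t) ⟩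
    cell M (ρ[ M ] (ρ[ ΦM M ] i)) (σ[ M ] (σ[ ΦM M ] t))              ≡⟨ cong₂ (λ j u → cell M (ρ[ M ] j) (σ[ M ] u)) (ρ[]-Φ M i) (σ[]-Φ M t) ⟩
    cell M (ρ[ M ] (ρ[ M ] i)) (σ[ M ] (σ[ M ] t))                    ≡⟨ cong₂ (cell M) (ρ[]-involutive M i) (σ[]-involutive M t) ⟩
    cell M i t                                                        ∎

occ[_] : Orientation → ∀ {n} → Vec ℕ n → Fin n → Fin n → Bool
occ[ ascending ] = occ01
occ[ descending ] = occ10

∧₄-elim : ∀ {a b c d} → a ∧ b ∧ c ∧ d ≡ true → T a × T b × T c × T d
∧₄-elim {true} {true} {true} {true} _ = _ , _ , _ , _

∧₄-intro : ∀ {a b c d} → T a → T b → T c → T d → a ∧ b ∧ c ∧ d ≡ true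
∧₄-intro {true} {true} {true} {true} _ _ _ _ = refl

occ-sound : ∀ o {n} (v : Vec ℕ n) t i → occ[ o ] v t i ≡ true → Occurrence o n (v !_) (toℕ t) (toℕ i)
occ-sound ascending v t i h with ∧₄-elim h
... | a , b , c , d = occurrence (<ᵇ⇒< _ _ a) (<ᵇ⇒< _ _ b) (<ᵇ⇒< _ _ c) (≡ᵇ⇒≡ _ _ d)
occ-sound descending v t i h with ∧₄-elim h
... | a , b , c , d = occurrence (<ᵇ⇒< _ _ a) (<ᵇ⇒< _ _ b) (<ᵇ⇒< _ _ d) (sym (≡ᵇ⇒≡ _ _ c))

occ-complete : ∀ o {n} (v : Vec ℕ n) t i → Occurrence o n (v !_) (toℕ t) (toℕ i) → occ[ o ] v t i ≡ true
occ-complete ascending v t i (occurrence a b c d) = ∧₄-intro (<⇒<ᵇ a) (<⇒<ᵇ b) (<⇒<ᵇ c) (≡⇒≡ᵇ _ _ d)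
occ-complete descending v t i (occurrence a b c d) = ∧₄-intro (<⇒<ᵇ a) (<⇒<ᵇ b) (≡⇒≡ᵇ _ _ (sym d)) (<⇒<ᵇ c)

cell-EmOf : ∀ {n} occ (v : Vec ℕ n) i t → cell (EmOf occ v) i t ≡ occ v t i
cell-EmOf occ v i t = trans (cong (λ row → lookup row t) (lookup∘tabulate _ i)) (lookup∘tabulate _ t)

occurrence-cong : ∀ {o n E F t i} → (∀ x → x < n → E x ≡ F x) → Occurrence o n E t i → Occurrence o n F t i
occurrence-cong {o} {n} {t = t} {i} E≗F (occurrence t<i i+1<n rise top≡) =
  occurrence t<i i+1<n (subst₂ (Rise o) (E≗F i i<n) (E≗F (suc i) i+1<n) rise)
             (trans (sym (E≗F (top o i) (≤-<-trans (top-≤ o i) i+1<n))) (trans top≡ (E≗F t (<-trans t<i i<n))))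
  where
  i<n : i < n
  i<n = <-trans (n<1+n i) i+1<n

module Reflected {n} (o : Orientation) (e : Vec ℕ n) (M : Triples n)
                 (inv : IsInvSeq e) (sub : M ⊆ᵀ EmOf occ[ o ] e) where

  E : ℕ → ℕ
  E = e !_

  occurrence-at : ∀ i t → cell M i t ≡ true → Occurrence o n E (toℕ t) (toℕ i)
  occurrence-at i t c = occ-sound o e t i (trans (sym (cell-EmOf occ[ o ] e i t))
                                                 ([]=⇒lookup (sub i (lookup⇒[]= t (lookup M i) c))))

  marked-occurrence : ∀ {r} → RowMarked M r → ∃ λ t → Occurrence o n E t r
  marked-occurrence (_ , i , refl , t , c) = toℕ t , occurrence-at i t c

  open SegmentsOf M using (σ; ρ)
  open ReflectOccurrences (rowMarked? M) proj₁ o E marked-occurrence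

  e′ : Vec ℕ n
  e′ = permute σ[ M ] e

  lookup-e′ : ∀ p → lookup e′ p ≡ E (σ (toℕ p))
  lookup-e′ p = begin
    lookup e′ p             ≡⟨ lookup-permute σ[ M ] e p ⟩
    lookup e (σ[ M ] p)     ≡⟨ !-lookup e (σ[ M ] p) ⟨
    e ! toℕ (σ[ M ] p)      ≡⟨ cong (e !_) (toℕ-σ[] M p) ⟩
    E (σ (toℕ p))           ∎
    where open ≡-Reasoning

  e′-! : ∀ x → x < n → E (σ x) ≡ e′ ! x
  e′-! x x<n = begin
    E (σ x)                            ≡⟨ cong (E ∘ σ) (toℕ-fromℕ< x<n) ⟨
    E (σ (toℕ (fromℕ< x<n)))           ≡⟨ lookup-e′ (fromℕ< x<n) ⟨
    lookup e′ (fromℕ< x<n)             ≡⟨ !-fromℕ< e′ x<n ⟨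
    e′ ! x                             ∎
    where open ≡-Reasoning

  Φ-inversion : IsInvSeq e′
  Φ-inversion p = subst (_≤ toℕ p) (sym (lookup-e′ p)) (reflect-inversion (inversion-ℕ {e = e} inv) (toℕ p) (toℕ<n p))

  -- a triple (t , i) of ΦM M is a triple (σ t , ρ i) of M, reflected
  Φ-occurrences : ΦM M ⊆ᵀ EmOf occ[ flip o ] e′
  Φ-occurrences i {t} mem = lookup⇒[]= t (lookup (EmOf occ[ flip o ] e′) i)
    (trans (cell-EmOf occ[ flip o ] e′ i t) (occ-complete (flip o) e′ t i (occurrence-cong e′-! reflected)))
    where
    c : cell M (ρ[ M ] i) (σ[ M ] t) ≡ true
    c = trans (sym (cell-Φ M i t)) ([]=⇒lookup mem)
    oc : Occurrence o n E (σ (toℕ t)) (ρ (toℕ i))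
    oc = subst₂ (Occurrence o n E) (toℕ-σ[] M t) (toℕ-ρ[] M i) (occurrence-at (ρ[ M ] i) (σ[ M ] t) c)
    reflected : Occurrence (flip o) n (E ∘ σ) (toℕ t) (toℕ i)
    reflected = reflected-occurrence oc (Occurrence.i+1<n oc , ρ[ M ] i , toℕ-ρ[] M i , σ[ M ] t , c)

Φ-marked : ∀ {n k} o → MarkedSeqs {n} (EmOf occ[ o ]) k → MarkedSeqs {n} (EmOf occ[ flip o ]) k
Φ-marked {k = k} o x = Φ (value x) , Irrelevant.map (valid (proj₁ (value x)) (proj₂ (value x))) (proof x)
  where
  valid : ∀ e M → IsInvSeq e × M ⊆ᵀ EmOf occ[ o ] e × card M ≡ k →
          IsInvSeq (permute σ[ M ] e) × ΦM M ⊆ᵀ EmOf occ[ flip o ] (permute σ[ M ] e) × card (ΦM M) ≡ k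
  valid e M (inv , sub , c) = Φ-inversion , Φ-occurrences , trans (card-Φ M) c
    where open Reflected o e M inv sub

lemma3p3 : (n k : ℕ) → MarkedSeqs {n} Em01 k ⤖ MarkedSeqs {n} Em10 k
lemma3p3 n k = ↔⇒⤖ (mk↔ₛ′ (Φ-marked ascending) (Φ-marked descending)
                          (λ y → value-injective (Φ-involutive (value y)))
                          (λ x → value-injective (Φ-involutive (value x))))
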